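{- Let $G$ be a finite simple graph, let $S\in\Psi(G)$, and let $H:=G-N[S]$. Let $\Psi_S(G):=\{U\in\Psi(G):S\subseteq U\}$ and $\Omega_S(G):=\{M\in\Omega(G):S\subseteq M\}$. Then $|\Psi_S(G)|=|\Psi(H)|$ and $|\Omega_S(G)|=|\Omega(H)|$.
   Context: For a graph $G$ and $X\subseteq V(G)$, $N(X)$ is the set of vertices adjacent to some vertex of $X$ and $N[X]=X\cup N(X)$; $G[X]$ is the induced subgraph on $X$ and $G-X:=G[V(G)\setminus X]$. $\Omega(G)$ is the family of all maximum independent sets of $G$. A set $S\subseteq V(G)$ is a local maximum independent set of $G$ if $S$ is a maximum independent set of $G[N[S]]$; $\Psi(G)$ denotes the family of all local maximum independent sets of $G$ (similarly for $H$). -}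

module Defs where

open import Data.Nat using (ℕ; zero; suc; _≤_; _≤?_)
open import Data.Fin using (Fin)
open import Data.Fin.Subset using (Subset; _∈_; _⊆_; _∪_; ∣_∣; inside; outside)
open import Data.Fin.Subset.Properties using (_∈?_; _⊆?_; anySubset?)
open import Data.Fin.Properties using (all?; any?)
open import Data.Bool using (Bool)
open import Data.Vec using (Vec; tabulate; []; _∷_)
open import Data.List using (List; length; filter; map; _++_)
open import Data.Product using (_×_; _,_; ∃; Σ)
open import Data.Empty using (⊥)
open import Relation.Nullary using (¬_; Dec; yes; no; does)
open import Relation.Nullary.Decidable using (_×-dec_; _→-dec_; ¬?; decidable-stable)
open import Relation.Unary using (Pred; Decidable)

record Graph (n : ℕ) : Set₁ where
  field
    Adj    : Fin n → Fin n → Set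
    adj?   : ∀ i j → Dec (Adj i j)
    sym    : ∀ {i j} → Adj i j → Adj j i
    irrefl : ∀ {i} → ¬ Adj i i
open Graph public

-- Throughout, a subset V ⊆ V(G) stands for the induced subgraph G[V];
-- V = ⊤ gives G itself, V = ∁ N[S] gives G - N[S].

N : ∀ {n} → Graph n → Subset n → Subset n → Subset n
N G V X = tabulate (λ v → does ((v ∈? V) ×-dec any? (λ x → (x ∈? X) ×-dec adj? G v x)))

N[_] : ∀ {n} → Graph n → Subset n → Subset n → Subset n
N[ G ] V X = X ∪ N G V X

-- X is independent (in G, equivalently in any induced subgraph containing X).
Independent : ∀ {n} → Graph n → Subset n → Set
Independent G X = ∀ i j → i ∈ X → j ∈ X → ¬ Adj G i j

IsMaxIndep : ∀ {n} → Graph n → Subset n → Subset n → Set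
IsMaxIndep G W U =
  U ⊆ W × Independent G U × (∀ T → T ⊆ W → Independent G T → ∣ T ∣ ≤ ∣ U ∣)

InΩ : ∀ {n} → Graph n → Subset n → Subset n → Set
InΩ G V U = IsMaxIndep G V U

InΨ : ∀ {n} → Graph n → Subset n → Subset n → Set
InΨ G V U = U ⊆ V × IsMaxIndep G (N[ G ] V U) U

independent? : ∀ {n} (G : Graph n) → Decidable (Independent G)
independent? G X = all? (λ i → all? (λ j → (i ∈? X) →-dec ((j ∈? X) →-dec ¬? (adj? G i j))))

isMaxIndep? : ∀ {n} (G : Graph n) (W : Subset n) → Decidable (IsMaxIndep G W)
isMaxIndep? G W U = (U ⊆? W) ×-dec (independent? G U ×-dec bound?)
  where
  bound? : Dec (∀ T → T ⊆ W → Independent G T → ∣ T ∣ ≤ ∣ U ∣)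
  bound? with anySubset? (λ T → (T ⊆? W) ×-dec (independent? G T ×-dec ¬? (∣ T ∣ ≤? ∣ U ∣)))
  ... | yes (T , T⊆W , iT , ¬le) = no (λ f → ¬le (f T T⊆W iT))
  ... | no ¬ex = yes (λ T T⊆W iT →
          decidable-stable (∣ T ∣ ≤? ∣ U ∣) (λ ¬le → ¬ex (T , T⊆W , iT , ¬le)))

inΩ? : ∀ {n} (G : Graph n) (V : Subset n) → Decidable (InΩ G V)
inΩ? G V = isMaxIndep? G V

inΨ? : ∀ {n} (G : Graph n) (V : Subset n) → Decidable (InΨ G V)
inΨ? G V U = (U ⊆? V) ×-dec isMaxIndep? G (N[ G ] V U) U

allSubsets : ∀ n → List (Subset n)
allSubsets zero = [] Data.List.∷ Data.List.[]
allSubsets (suc n) = map (inside ∷_) (allSubsets n) ++ map (outside ∷_) (allSubsets n)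

count : ∀ {n} {P : Pred (Subset n) Agda.Primitive.lzero} → Decidable P → ℕ
count {n} P? = length (filter P? (allSubsets n))

{-# OPTIONS --safe #-}
-- Both counts are realised by the symmetric difference with S, which removes S
-- from sets containing it and adds S to subsets of V(H) = V ∖ N[S]; being an
-- involution of the subset cube, it is a bijection as soon as it maps each
-- family into the other. An independent U ⊇ S meets N[S] only in S, and nothing
-- in V(H) is adjacent to S, so sizes shift by exactly ∣ S ∣ between U and U ∖ S.
-- Going back, local maximality of S bounds every independent T of G by
-- ∣ T ∩ V(H) ∣ + ∣ S ∣, as T ∩ N[S] is independent inside N[S]. For Ψ the same
-- computation runs inside closed neighbourhoods, since N[U] ∩ V(H) = N_H[U ∖ S].
module Submission where

open import Defs
open import Data.Nat using (ℕ)
open import Data.Fin.Subset using (Subset; _⊆_; ⊤; ∁)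
open import Data.Fin.Subset.Properties using (_⊆?_)
open import Data.Product using (_×_)
open import Relation.Binary.PropositionalEquality using (_≡_)
open import Relation.Nullary.Decidable using (_×-dec_)

open import Data.Bool using (_xor_)
open import Data.Bool.Properties using (T-≡)
open import Data.Empty using (⊥-elim)
open import Data.Fin using (Fin)
open import Data.Fin.Properties using (any?)
open import Data.Fin.Subset using (_∈_; _∉_; _∪_; _∩_; ∣_∣; inside; outside)
open import Data.Fin.Subset.Properties
  using (_∈?_; drop-there; ∈⊤; ⊆⊤; p⊆p∪q; q⊆p∪q; x∈p∪q⁻; x∈p∩q⁻; p∩q⊆p; p∩q⊆q; x∈∁p⇒x∉p; x∉p⇒x∈∁p)
open import Data.List as List using (List; length; filter; map; _++_)
open import Data.List.Properties using (length-++; filter-++)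
open import Data.Nat using (suc; _+_; _≤_)
open import Data.Nat.Properties using (+-comm; +-suc; +-monoˡ-≤; +-monoʳ-≤; +-cancelʳ-≤; module ≤-Reasoning)
open import Data.Product using (∃; _,_; proj₁; proj₂)
open import Data.Sum using (_⊎_; inj₁; inj₂; [_,_]′; map₂)
open import Data.Vec using ([]; _∷_; lookup; here; there; zipWith)
open import Data.Vec.Properties using (lookup∘tabulate; []=⇒lookup; lookup⇒[]=)
open import Function using (_∘_; Equivalence)
open import Level using (0ℓ)
open import Relation.Binary.PropositionalEquality using (refl; cong; cong₂; trans; module ≡-Reasoning)
import Relation.Binary.PropositionalEquality as ≡
open import Relation.Nullary using (¬_; Dec; yes; no)
open import Relation.Nullary.Decidable using (does; isYes; isYes≗does; toWitness; dec-true)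
open import Relation.Unary using (Pred; Decidable)

private
  variable
    n : ℕ
    x y : Fin n
    p q A B T U V V′ W X X′ Y : Subset n

infixr 6 _⊕_

_⊕_ : Subset n → Subset n → Subset n
_⊕_ = zipWith _xor_

x∈p⊕q⁻ : ∀ (p q : Subset n) → x ∈ p ⊕ q → (x ∈ p × x ∉ q) ⊎ (x ∉ p × x ∈ q)
x∈p⊕q⁻ (inside  ∷ p) (outside ∷ q) here = inj₁ (here , λ ())
x∈p⊕q⁻ (outside ∷ p) (inside  ∷ q) here = inj₂ ((λ ()) , here)
x∈p⊕q⁻ (_ ∷ p) (_ ∷ q) (there x∈p⊕q) with x∈p⊕q⁻ p q x∈p⊕q
... | inj₁ (x∈p , x∉q) = inj₁ (there x∈p , x∉q ∘ drop-there)
... | inj₂ (x∉p , x∈q) = inj₂ (x∉p ∘ drop-there , there x∈q)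

x∉p∧x∈q⇒x∈p⊕q : ∀ (p q : Subset n) → x ∉ p → x ∈ q → x ∈ p ⊕ q
x∉p∧x∈q⇒x∈p⊕q (inside  ∷ p) (inside ∷ q) x∉p here        = ⊥-elim (x∉p here)
x∉p∧x∈q⇒x∈p⊕q (outside ∷ p) (inside ∷ q) x∉p here        = here
x∉p∧x∈q⇒x∈p⊕q (_       ∷ p) (_      ∷ q) x∉p (there x∈q) = there (x∉p∧x∈q⇒x∈p⊕q p q (x∉p ∘ there) x∈q)

p⊕q⊆p∪q : ∀ (p q : Subset n) → p ⊕ q ⊆ p ∪ q
p⊕q⊆p∪q p q x∈p⊕q with x∈p⊕q⁻ p q x∈p⊕q
... | inj₁ (x∈p , _) = p⊆p∪q q x∈p
... | inj₂ (_ , x∈q) = q⊆p∪q p q x∈q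

q⊆p⇒x∈p⊕q⁻ : ∀ (p q : Subset n) → q ⊆ p → x ∈ p ⊕ q → x ∈ p × x ∉ q
q⊆p⇒x∈p⊕q⁻ p q q⊆p x∈p⊕q with x∈p⊕q⁻ p q x∈p⊕q
... | inj₁ x∈p∖q        = x∈p∖q
... | inj₂ (x∉p , x∈q) = ⊥-elim (x∉p (q⊆p x∈q))

∣p⊕q∣≡∣p∣+∣q∣ : ∀ (p q : Subset n) → (∀ {x} → x ∈ p → x ∉ q) → ∣ p ⊕ q ∣ ≡ ∣ p ∣ + ∣ q ∣
∣p⊕q∣≡∣p∣+∣q∣ []            []            _        = refl
∣p⊕q∣≡∣p∣+∣q∣ (inside  ∷ p) (inside  ∷ q) disjoint = ⊥-elim (disjoint here here)
∣p⊕q∣≡∣p∣+∣q∣ (inside  ∷ p) (outside ∷ q) disjoint = cong suc (∣p⊕q∣≡∣p∣+∣q∣ p q (λ x∈p → disjoint (there x∈p) ∘ there))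
∣p⊕q∣≡∣p∣+∣q∣ (outside ∷ p) (inside  ∷ q) disjoint =
  trans (cong suc (∣p⊕q∣≡∣p∣+∣q∣ p q (λ x∈p → disjoint (there x∈p) ∘ there))) (≡.sym (+-suc ∣ p ∣ ∣ q ∣))
∣p⊕q∣≡∣p∣+∣q∣ (outside ∷ p) (outside ∷ q) disjoint = ∣p⊕q∣≡∣p∣+∣q∣ p q (λ x∈p → disjoint (there x∈p) ∘ there)

q⊆p⇒∣p⊕q∣+∣q∣≡∣p∣ : ∀ (p q : Subset n) → q ⊆ p → ∣ p ⊕ q ∣ + ∣ q ∣ ≡ ∣ p ∣
q⊆p⇒∣p⊕q∣+∣q∣≡∣p∣ []            []            _   = refl
q⊆p⇒∣p⊕q∣+∣q∣≡∣p∣ (inside  ∷ p) (inside  ∷ q) q⊆p =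
  trans (+-suc ∣ p ⊕ q ∣ ∣ q ∣) (cong suc (q⊆p⇒∣p⊕q∣+∣q∣≡∣p∣ p q (drop-there ∘ q⊆p ∘ there)))
q⊆p⇒∣p⊕q∣+∣q∣≡∣p∣ (inside  ∷ p) (outside ∷ q) q⊆p = cong suc (q⊆p⇒∣p⊕q∣+∣q∣≡∣p∣ p q (drop-there ∘ q⊆p ∘ there))
q⊆p⇒∣p⊕q∣+∣q∣≡∣p∣ (outside ∷ p) (inside  ∷ q) q⊆p with q⊆p here
... | ()
q⊆p⇒∣p⊕q∣+∣q∣≡∣p∣ (outside ∷ p) (outside ∷ q) q⊆p = q⊆p⇒∣p⊕q∣+∣q∣≡∣p∣ p q (drop-there ∘ q⊆p ∘ there)

∣p∣≡∣p∩∁q∣+∣p∩q∣ : ∀ (p q : Subset n) → ∣ p ∣ ≡ ∣ p ∩ ∁ q ∣ + ∣ p ∩ q ∣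
∣p∣≡∣p∩∁q∣+∣p∩q∣ []            []            = refl
∣p∣≡∣p∩∁q∣+∣p∩q∣ (inside  ∷ p) (inside  ∷ q) =
  trans (cong suc (∣p∣≡∣p∩∁q∣+∣p∩q∣ p q)) (≡.sym (+-suc ∣ p ∩ ∁ q ∣ ∣ p ∩ q ∣))
∣p∣≡∣p∩∁q∣+∣p∩q∣ (inside  ∷ p) (outside ∷ q) = cong suc (∣p∣≡∣p∩∁q∣+∣p∩q∣ p q)
∣p∣≡∣p∩∁q∣+∣p∩q∣ (outside ∷ p) (_       ∷ q) = ∣p∣≡∣p∩∁q∣+∣p∩q∣ p q

length-filter-map : ∀ {A B : Set} {P : Pred B 0ℓ} (P? : Decidable P) (f : A → B) (xs : List A) →
  length (filter P? (map f xs)) ≡ length (filter (P? ∘ f) xs)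
length-filter-map P? f List.[]       = refl
length-filter-map P? f (x List.∷ xs) with P? (f x)
... | yes _ = cong suc (length-filter-map P? f xs)
... | no  _ = length-filter-map P? f xs

count-suc : ∀ {P : Pred (Subset (suc n)) 0ℓ} (P? : Decidable P) →
  count P? ≡ count (P? ∘ (inside ∷_)) + count (P? ∘ (outside ∷_))
count-suc {n} P? = begin
  length (filter P? (ins ++ outs))                     ≡⟨ cong length (filter-++ P? ins outs) ⟩
  length (filter P? ins ++ filter P? outs)             ≡⟨ length-++ (filter P? ins) ⟩
  length (filter P? ins) + length (filter P? outs)     ≡⟨ cong₂ _+_ (length-filter-map P? (inside ∷_) (allSubsets n))
                                                                     (length-filter-map P? (outside ∷_) (allSubsets n)) ⟩
  count (P? ∘ (inside ∷_)) + count (P? ∘ (outside ∷_)) ∎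
  where
  open ≡-Reasoning
  ins outs : List (Subset (suc n))
  ins  = map (inside ∷_) (allSubsets n)
  outs = map (outside ∷_) (allSubsets n)

-- Translation by s is an involution of the cube of subsets, so the two
-- implications already make it a bijection between P and Q.
count-≡-by-⊕ : ∀ {P Q : Pred (Subset n) 0ℓ} (P? : Decidable P) (Q? : Decidable Q) (s : Subset n) →
  (∀ x → P x → Q (x ⊕ s)) → (∀ y → Q y → P (y ⊕ s)) → count P? ≡ count Q?
count-≡-by-⊕ P? Q? [] P⇒Q Q⇒P with P? [] | Q? []
... | yes _  | yes _  = refl
... | no  _  | no  _  = refl
... | yes Px | no ¬Qx = ⊥-elim (¬Qx (P⇒Q [] Px))
... | no ¬Px | yes Qx = ⊥-elim (¬Px (Q⇒P [] Qx))
count-≡-by-⊕ {suc n} P? Q? (inside ∷ s) P⇒Q Q⇒P = begin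
  count P?                                             ≡⟨ count-suc P? ⟩
  count (P? ∘ (inside ∷_)) + count (P? ∘ (outside ∷_)) ≡⟨ cong₂ _+_ in⇔out out⇔in ⟩
  count (Q? ∘ (outside ∷_)) + count (Q? ∘ (inside ∷_)) ≡⟨ +-comm (count (Q? ∘ (outside ∷_))) _ ⟩
  count (Q? ∘ (inside ∷_)) + count (Q? ∘ (outside ∷_)) ≡⟨ count-suc Q? ⟨
  count Q?                                             ∎
  where
  open ≡-Reasoning
  in⇔out : count (P? ∘ (inside ∷_)) ≡ count (Q? ∘ (outside ∷_))
  in⇔out = count-≡-by-⊕ (P? ∘ (inside ∷_)) (Q? ∘ (outside ∷_)) s (P⇒Q ∘ (inside ∷_)) (Q⇒P ∘ (outside ∷_))
  out⇔in : count (P? ∘ (outside ∷_)) ≡ count (Q? ∘ (inside ∷_))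
  out⇔in = count-≡-by-⊕ (P? ∘ (outside ∷_)) (Q? ∘ (inside ∷_)) s (P⇒Q ∘ (outside ∷_)) (Q⇒P ∘ (inside ∷_))
count-≡-by-⊕ {suc n} P? Q? (outside ∷ s) P⇒Q Q⇒P = begin
  count P?                                             ≡⟨ count-suc P? ⟩
  count (P? ∘ (inside ∷_)) + count (P? ∘ (outside ∷_)) ≡⟨ cong₂ _+_ in⇔in out⇔out ⟩
  count (Q? ∘ (inside ∷_)) + count (Q? ∘ (outside ∷_)) ≡⟨ count-suc Q? ⟨
  count Q?                                             ∎
  where
  open ≡-Reasoning
  in⇔in : count (P? ∘ (inside ∷_)) ≡ count (Q? ∘ (inside ∷_))
  in⇔in = count-≡-by-⊕ (P? ∘ (inside ∷_)) (Q? ∘ (inside ∷_)) s (P⇒Q ∘ (inside ∷_)) (Q⇒P ∘ (inside ∷_))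
  out⇔out : count (P? ∘ (outside ∷_)) ≡ count (Q? ∘ (outside ∷_))
  out⇔out = count-≡-by-⊕ (P? ∘ (outside ∷_)) (Q? ∘ (outside ∷_)) s (P⇒Q ∘ (outside ∷_)) (Q⇒P ∘ (outside ∷_))

module _ (G : Graph n) where

  private
    neighbourIn? : (V X : Subset n) (x : Fin n) → Dec (x ∈ V × ∃ λ y → y ∈ X × Adj G x y)
    neighbourIn? V X x = (x ∈? V) ×-dec any? (λ y → (y ∈? X) ×-dec adj? G x y)

  x∈N⁻ : x ∈ N G V X → x ∈ V × ∃ λ y → y ∈ X × Adj G x y
  x∈N⁻ {x = x} {V = V} {X = X} x∈N = toWitness (Equivalence.from T-≡ (begin
    isYes (neighbourIn? V X x)       ≡⟨ isYes≗does (neighbourIn? V X x) ⟩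
    does (neighbourIn? V X x)        ≡⟨ lookup∘tabulate _ x ⟨
    lookup (N G V X) x               ≡⟨ []=⇒lookup x∈N ⟩
    inside                           ∎))
    where open ≡-Reasoning

  x∈N⁺ : x ∈ V → y ∈ X → Adj G x y → x ∈ N G V X
  x∈N⁺ {x = x} {V = V} {X = X} x∈V y∈X xy =
    lookup⇒[]= x _ (trans (lookup∘tabulate _ x) (dec-true (neighbourIn? V X x) (x∈V , _ , y∈X , xy)))

  x∈N[]⁻ : x ∈ N[ G ] V X → x ∈ X ⊎ (x ∈ V × ∃ λ y → y ∈ X × Adj G x y)
  x∈N[]⁻ {X = X} x∈N[X] = map₂ x∈N⁻ (x∈p∪q⁻ X _ x∈N[X])

  x∈N[]⁺ˡ : x ∈ X → x ∈ N[ G ] V X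
  x∈N[]⁺ˡ = p⊆p∪q _

  x∈N[]⁺ʳ : x ∈ V → y ∈ X → Adj G x y → x ∈ N[ G ] V X
  x∈N[]⁺ʳ x∈V y∈X xy = q⊆p∪q _ _ (x∈N⁺ x∈V y∈X xy)

  N[]-mono : V ⊆ V′ → X ⊆ X′ → N[ G ] V X ⊆ N[ G ] V′ X′
  N[]-mono V⊆V′ X⊆X′ x∈N[X] with x∈N[]⁻ x∈N[X]
  ... | inj₁ x∈X                    = x∈N[]⁺ˡ (X⊆X′ x∈X)
  ... | inj₂ (x∈V , y , y∈X , xy) = x∈N[]⁺ʳ (V⊆V′ x∈V) (X⊆X′ y∈X) xy

  N[]⊆ : X ⊆ V → N[ G ] V X ⊆ V
  N[]⊆ X⊆V x∈N[X] with x∈N[]⁻ x∈N[X]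
  ... | inj₁ x∈X           = X⊆V x∈X
  ... | inj₂ (x∈V , _) = x∈V

  x∈N[]-restrict : x ∈ V → x ∈ N[ G ] V′ X → x ∈ N[ G ] V X
  x∈N[]-restrict x∈V x∈N[X] with x∈N[]⁻ x∈N[X]
  ... | inj₁ x∈X                   = x∈N[]⁺ˡ x∈X
  ... | inj₂ (_ , y , y∈X , xy) = x∈N[]⁺ʳ x∈V y∈X xy

  x∈N[X∪Y]∧x∉N[Y]⇒x∈N[X] : x ∉ N[ G ] ⊤ Y → x ∈ N[ G ] V (X ∪ Y) → x ∈ N[ G ] V X
  x∈N[X∪Y]∧x∉N[Y]⇒x∈N[X] {Y = Y} {X = X} x∉N[Y] x∈N[X∪Y] with x∈N[]⁻ x∈N[X∪Y]
  ... | inj₁ x∈X∪Y =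
    [ x∈N[]⁺ˡ , ⊥-elim ∘ x∉N[Y] ∘ x∈N[]⁺ˡ ]′ (x∈p∪q⁻ X Y x∈X∪Y)
  ... | inj₂ (x∈V , y , y∈X∪Y , xy) =
    [ (λ y∈X → x∈N[]⁺ʳ x∈V y∈X xy) , (λ y∈Y → ⊥-elim (x∉N[Y] (x∈N[]⁺ʳ ∈⊤ y∈Y xy))) ]′ (x∈p∪q⁻ X Y y∈X∪Y)

  independent-antimono : p ⊆ q → Independent G q → Independent G p
  independent-antimono p⊆q indQ x y x∈p y∈p = indQ x y (p⊆q x∈p) (p⊆q y∈p)

  independent-⊕ : Independent G p → Independent G q → (∀ {x y} → x ∈ p → y ∈ q → ¬ Adj G x y) →
                  Independent G (p ⊕ q)
  independent-⊕ {p = p} {q = q} indP indQ p↮q x y x∈p⊕q y∈p⊕q with x∈p⊕q⁻ p q x∈p⊕q | x∈p⊕q⁻ p q y∈p⊕q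
  ... | inj₁ (x∈p , _) | inj₁ (y∈p , _) = indP x y x∈p y∈p
  ... | inj₁ (x∈p , _) | inj₂ (_ , y∈q) = p↮q x∈p y∈q
  ... | inj₂ (_ , x∈q) | inj₁ (y∈p , _) = p↮q y∈p x∈q ∘ Graph.sym G
  ... | inj₂ (_ , x∈q) | inj₂ (_ , y∈q) = indQ x y x∈q y∈q

  module _ (S : Subset n) where

    V-H : Subset n
    V-H = ∁ (N[ G ] ⊤ S)

    x∈V-H⇒x∉S : x ∈ V-H → x ∉ S
    x∈V-H⇒x∉S x∈V-H = x∈∁p⇒x∉p x∈V-H ∘ x∈N[]⁺ˡ

    x∈V-H∧y∈S⇒¬Adj : x ∈ V-H → y ∈ S → ¬ Adj G x y
    x∈V-H∧y∈S⇒¬Adj x∈V-H y∈S = x∈∁p⇒x∉p x∈V-H ∘ x∈N[]⁺ʳ ∈⊤ y∈S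

    S⊆W⊕S : W ⊆ V-H → S ⊆ W ⊕ S
    S⊆W⊕S {W = W} W⊆V-H y∈S = x∉p∧x∈q⇒x∈p⊕q W S (λ y∈W → x∈V-H⇒x∉S (W⊆V-H y∈W) y∈S) y∈S

    ∣W⊕S∣≡∣W∣+∣S∣ : W ⊆ V-H → ∣ W ⊕ S ∣ ≡ ∣ W ∣ + ∣ S ∣
    ∣W⊕S∣≡∣W∣+∣S∣ {W = W} W⊆V-H = ∣p⊕q∣≡∣p∣+∣q∣ W S (x∈V-H⇒x∉S ∘ W⊆V-H)

    independent-⊕S : Independent G S → Independent G W → W ⊆ V-H → Independent G (W ⊕ S)
    independent-⊕S indS indW W⊆V-H = independent-⊕ indW indS (x∈V-H∧y∈S⇒¬Adj ∘ W⊆V-H)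

    independent∧S⊆U⇒U⊕S⊆V-H : Independent G U → S ⊆ U → U ⊕ S ⊆ V-H
    independent∧S⊆U⇒U⊕S⊆V-H {U = U} indU S⊆U x∈U⊕S with q⊆p⇒x∈p⊕q⁻ U S S⊆U x∈U⊕S
    ... | x∈U , x∉S = x∉p⇒x∈∁p λ x∈N[S] →
      [ x∉S , (λ (_ , y , y∈S , xy) → indU _ _ x∈U (S⊆U y∈S) xy) ]′ (x∈N[]⁻ x∈N[S])

    -- A and B are the vertex sets in which maximality is measured, in G and in H:
    -- ⊤ and V-H for Ω, the closed neighbourhoods N[U] and N_H[U ⊕ S] for Ψ.
    isMaxIndep-shrink : S ⊆ U → IsMaxIndep G A U → U ⊕ S ⊆ B →
                        (∀ {T} → T ⊆ B → T ⊆ V-H × T ⊕ S ⊆ A) → IsMaxIndep G B (U ⊕ S)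
    isMaxIndep-shrink {U = U} {A = A} {B = B} S⊆U (_ , indU , maxU) U⊕S⊆B hosts =
      U⊕S⊆B , independent-antimono (proj₁ ∘ q⊆p⇒x∈p⊕q⁻ U S S⊆U) indU , bound
      where
      bound : ∀ T → T ⊆ B → Independent G T → ∣ T ∣ ≤ ∣ U ⊕ S ∣
      bound T T⊆B indT = +-cancelʳ-≤ ∣ S ∣ ∣ T ∣ (∣ U ⊕ S ∣) (begin
        ∣ T ∣ + ∣ S ∣     ≡⟨ ∣W⊕S∣≡∣W∣+∣S∣ T⊆V-H ⟨
        ∣ T ⊕ S ∣         ≤⟨ maxU (T ⊕ S) T⊕S⊆A (independent-⊕S (independent-antimono S⊆U indU) indT T⊆V-H) ⟩
        ∣ U ∣             ≡⟨ q⊆p⇒∣p⊕q∣+∣q∣≡∣p∣ U S S⊆U ⟨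
        ∣ U ⊕ S ∣ + ∣ S ∣ ∎)
        where
        open ≤-Reasoning
        T⊆V-H : T ⊆ V-H
        T⊆V-H = proj₁ (hosts T⊆B)
        T⊕S⊆A : T ⊕ S ⊆ A
        T⊕S⊆A = proj₂ (hosts T⊆B)

    Ω-shrink : InΩ G ⊤ U → S ⊆ U → InΩ G V-H (U ⊕ S)
    Ω-shrink ωU@(_ , indU , _) S⊆U =
      isMaxIndep-shrink S⊆U ωU (independent∧S⊆U⇒U⊕S⊆V-H indU S⊆U) (λ T⊆V-H → T⊆V-H , ⊆⊤)

    Ψ-shrink : InΨ G ⊤ U → S ⊆ U → InΨ G V-H (U ⊕ S)
    Ψ-shrink {U = U} (_ , ψU@(_ , indU , _)) S⊆U = U⊕S⊆V-H , isMaxIndep-shrink S⊆U ψU x∈N[]⁺ˡ hosts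
      where
      U⊕S⊆V-H : U ⊕ S ⊆ V-H
      U⊕S⊆V-H = independent∧S⊆U⇒U⊕S⊆V-H indU S⊆U
      U⊕S⊆U : U ⊕ S ⊆ U
      U⊕S⊆U = proj₁ ∘ q⊆p⇒x∈p⊕q⁻ U S S⊆U
      hosts : T ⊆ N[ G ] V-H (U ⊕ S) → T ⊆ V-H × T ⊕ S ⊆ N[ G ] ⊤ U
      hosts {T = T} T⊆N[U⊕S] =
        N[]⊆ U⊕S⊆V-H ∘ T⊆N[U⊕S] ,
        [ N[]-mono ⊆⊤ U⊕S⊆U ∘ T⊆N[U⊕S] , x∈N[]⁺ˡ ∘ S⊆U ]′ ∘ x∈p∪q⁻ T S ∘ p⊕q⊆p∪q T S

    module _ (S-max : IsMaxIndep G (N[ G ] ⊤ S) S) where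

      independent⇒∣T∣≤∣T∩V-H∣+∣S∣ : Independent G T → ∣ T ∣ ≤ ∣ T ∩ V-H ∣ + ∣ S ∣
      independent⇒∣T∣≤∣T∩V-H∣+∣S∣ {T = T} indT = begin
        ∣ T ∣                     ≡⟨ ∣p∣≡∣p∩∁q∣+∣p∩q∣ T (N[ G ] ⊤ S) ⟩
        ∣ T ∩ V-H ∣ + ∣ T ∩ N[S] ∣ ≤⟨ +-monoʳ-≤ ∣ T ∩ V-H ∣ T∩N[S]-bound ⟩
        ∣ T ∩ V-H ∣ + ∣ S ∣        ∎
        where
        open ≤-Reasoning
        N[S] : Subset _
        N[S] = N[ G ] ⊤ S
        T∩N[S]-bound : ∣ T ∩ N[S] ∣ ≤ ∣ S ∣
        T∩N[S]-bound = proj₂ (proj₂ S-max) (T ∩ N[S]) (p∩q⊆q T N[S]) (independent-antimono (p∩q⊆p T N[S]) indT)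

      isMaxIndep-extend : IsMaxIndep G B W → W ⊆ V-H → W ⊕ S ⊆ A →
                          (∀ {T} → T ⊆ A → T ∩ V-H ⊆ B) → IsMaxIndep G A (W ⊕ S)
      isMaxIndep-extend {W = W} (_ , indW , maxW) W⊆V-H W⊕S⊆A hosts =
        W⊕S⊆A , independent-⊕S (proj₁ (proj₂ S-max)) indW W⊆V-H , λ T T⊆A indT → begin
          ∣ T ∣               ≤⟨ independent⇒∣T∣≤∣T∩V-H∣+∣S∣ indT ⟩
          ∣ T ∩ V-H ∣ + ∣ S ∣ ≤⟨ +-monoˡ-≤ ∣ S ∣ (maxW (T ∩ V-H) (hosts T⊆A) (independent-antimono (p∩q⊆p T V-H) indT)) ⟩
          ∣ W ∣ + ∣ S ∣       ≡⟨ ∣W⊕S∣≡∣W∣+∣S∣ W⊆V-H ⟨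
          ∣ W ⊕ S ∣           ∎
        where open ≤-Reasoning

      Ω-extend : InΩ G V-H W → InΩ G ⊤ (W ⊕ S)
      Ω-extend ωW@(W⊆V-H , _) = isMaxIndep-extend ωW W⊆V-H ⊆⊤ (λ {T} _ → p∩q⊆q T V-H)

      Ψ-extend : InΨ G V-H W → InΨ G ⊤ (W ⊕ S)
      Ψ-extend {W = W} (W⊆V-H , ψW) = ⊆⊤ , isMaxIndep-extend ψW W⊆V-H x∈N[]⁺ˡ hosts
        where
        hosts : T ⊆ N[ G ] ⊤ (W ⊕ S) → T ∩ V-H ⊆ N[ G ] V-H W
        hosts {T = T} T⊆N[W⊕S] x∈T∩V-H with x∈p∩q⁻ T V-H x∈T∩V-H
        ... | x∈T , x∈V-H = x∈N[X∪Y]∧x∉N[Y]⇒x∈N[X] (x∈∁p⇒x∉p x∈V-H)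
                              (x∈N[]-restrict x∈V-H (N[]-mono ⊆⊤ (p⊕q⊆p∪q W S) (T⊆N[W⊕S] x∈T)))

corollary3p7 : ∀ {n} (G : Graph n) (S : Subset n) → InΨ G ⊤ S →
    let V-H = ∁ (N[ G ] ⊤ S) in
    count (λ U → inΨ? G ⊤ U ×-dec (S ⊆? U)) ≡ count (inΨ? G V-H)
    × count (λ U → inΩ? G ⊤ U ×-dec (S ⊆? U)) ≡ count (inΩ? G V-H)
corollary3p7 G S (_ , S-localMax) =
  count-≡-by-⊕ (λ U → inΨ? G ⊤ U ×-dec (S ⊆? U)) (inΨ? G (V-H G S)) S
    (λ U (ψU , S⊆U) → Ψ-shrink G S ψU S⊆U)
    (λ W ψW → Ψ-extend G S S-localMax ψW , S⊆W⊕S G S (proj₁ ψW)) ,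
  count-≡-by-⊕ (λ U → inΩ? G ⊤ U ×-dec (S ⊆? U)) (inΩ? G (V-H G S)) S
    (λ U (ωU , S⊆U) → Ω-shrink G S ωU S⊆U)
    (λ W ωW → Ω-extend G S S-localMax ωW , S⊆W⊕S G S (proj₁ ωW))
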